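{- $\displaystyle\lim_{n\to\infty}\frac{\mu(n)}{n}=\frac12$.
   Context: $\mathbb{F}_2$ is the field with two elements. For $u\in\mathbb{F}_2^n$, $|u|$ is the number of entries of $u$ equal to $1$. For an $n\times n$ matrix $W$ over $\mathbb{F}_2$, $M(W,0)=\max\{|Wx| : x\in\mathbb{F}_2^n\}$. $\mu(n)$ is the minimum of $M(W,0)$ over all $n\times n$ matrices $W$ over $\mathbb{F}_2$ whose diagonal entries are all equal to $1$. -}

module Defs where

open import Data.Bool using (Bool; true; false; _xor_; _∧_; if_then_else_)
open import Data.Nat using (ℕ; zero; suc; _+_; _⊓_; _⊔_)
open import Data.Fin using (Fin)
open import Data.Vec using (Vec; []; _∷_; lookup; tabulate; toList; zipWith; foldr)
open import Data.List as L using (List; concatMap; filterᵇ; map)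
open import Data.Bool.ListAction using (and)

-- Elements of 𝔽₂ are represented by Bool (false = 0, true = 1);
-- addition is xor, multiplication is ∧.

weight : ∀ {n} → Vec Bool n → ℕ
weight [] = 0
weight (b ∷ u) = (if b then 1 else 0) + weight u

-- An n×n matrix over 𝔽₂ (row-major: lookup (lookup W i) j = W_ij).
Mat : ℕ → Set
Mat n = Vec (Vec Bool n) n

dot : ∀ {n} → Vec Bool n → Vec Bool n → Bool
dot u v = foldr _ _xor_ false (zipWith _∧_ u v)

mulV : ∀ {n} → Mat n → Vec Bool n → Vec Bool n
mulV W x = Data.Vec.map (λ row → dot row x) W

allVecsOver : ∀ {A : Set} (m : ℕ) → List A → List (Vec A m)
allVecsOver zero xs = [] L.∷ L.[]
allVecsOver (suc m) xs = concatMap (λ v → map (λ a → a ∷ v) xs) (allVecsOver m xs)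

allVecs : (n : ℕ) → List (Vec Bool n)
allVecs n = allVecsOver n (false L.∷ true L.∷ L.[])

allMats : (n : ℕ) → List (Mat n)
allMats n = allVecsOver n (allVecs n)

unitDiag : ∀ {n} → Mat n → Bool
unitDiag {n} W = and (toList (tabulate {n = n} (λ i → lookup (lookup W i) i)))

M0 : ∀ {n} → Mat n → ℕ
M0 {n} W = L.foldr _⊔_ 0 (map (λ x → weight (mulV W x)) (allVecs n))

-- μ(n) = min of M(W,0) over n×n matrices with all diagonal entries 1.
-- The fold starts at n, which is harmless since M(W,0) ≤ n for every W
-- (and the list is nonempty: it contains the identity matrix).
μ : ℕ → ℕ
μ n = L.foldr _⊓_ n (map M0 (filterᵇ unitDiag (allMats n)))

module Submission where

-- Lower bound: if a row r of W is nonzero then r · x = 1 for exactly half of all x ∈ 𝔽₂ⁿ, so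
-- when the diagonal is 1 the average of |Wx| over x is n/2, and hence M(W,0) ≥ n/2.
--
-- Upper bound: let u₁, …, uₙ list every nonzero vector of 𝔽₂ᵏ⁺¹ t times, followed by r copies
-- of e₁, and let Wᵢⱼ = uᵢ · pivot uⱼ, where pivot u is the unit vector at the first nonzero
-- coordinate of u. Then Wᵢᵢ = 1 and Wx = (uᵢ · y)ᵢ with y = Σⱼ xⱼ pivot uⱼ. At most half of the
-- vectors of 𝔽₂ᵏ⁺¹ have u · y = 1, so |Wx| ≤ t·2ᵏ + r, i.e. 2μ(n) ≤ n + t + r for
-- n = t(2ᵏ⁺¹ − 1) + r. Choosing L = 2ᵏ⁺¹ − 1 at least the denominator of ε, writing n = tL + r
-- with r < L and taking n > L² makes |μ(n)/n − ½| = (2μ(n) − n)/2n < ε.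

module Bounds where

  open import Defs

  open import Algebra.Bundles using (CommutativeMonoid; CommutativeRing)
  open import Data.Bool using (Bool; true; false; not; _∧_; _∨_; _xor_; if_then_else_; T)
  open import Data.Bool.ListAction using (and)
  open import Data.Bool.Properties
    using (∧-comm; ∧-zeroʳ; ∧-distribˡ-xor; ∧-commutativeMonoid; xor-∧-commutativeRing)
  open import Data.Fin using (Fin; zero; suc)
  open import Data.List using (List; []; _∷_; _++_; concat; concatMap; replicate; filterᵇ; length; foldr)
  open import Data.List.Membership.Propositional using (_∈_)
  open import Data.List.Membership.Propositional.Properties using (∈-map⁺; ∈-filter⁺; ∈-concat⁺′)
  open import Data.List.Properties using (foldr-preservesᵇ; foldr-preservesᵒ)
  open import Data.List.Relation.Unary.All as All using (All)
  import Data.List.Relation.Unary.All.Properties as All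
  open import Data.List.Relation.Unary.Any as Any using (here; there)
  open import Data.Nat
  open import Data.Nat.Properties
  open import Data.Nat.Tactic.RingSolver using (solve-∀)
  open import Data.Product using (∃-syntax; _,_)
  open import Data.Sum using (inj₂; [_,_])
  open import Data.Vec as Vec using (Vec; []; _∷_; lookup; tabulate; toList; zipWith)
  import Data.Vec.Properties as Vec
  import Data.Vec.Relation.Unary.All.Properties as VecAll
  open import Function using (_∘_)
  open import Relation.Binary.PropositionalEquality hiding ([_])
  open import Relation.Nullary.Decidable using (T?)

  open import Algebra.Properties.CommutativeSemigroup +-commutativeSemigroup
    using () renaming (interchange to +-interchange)
  open import Algebra.Properties.CommutativeSemigroup *-commutativeSemigroup
    using () renaming (x∙yz≈y∙xz to *-left-comm)
  open import Algebra.Properties.CommutativeSemigroup (CommutativeMonoid.commutativeSemigroup ∧-commutativeMonoid)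
    using () renaming (x∙yz≈y∙xz to ∧-left-comm)
  open import Algebra.Properties.CommutativeSemigroup (CommutativeRing.+-commutativeSemigroup xor-∧-commutativeRing)
    using () renaming (interchange to xor-interchange)

  private
    variable
      A B : Set
      k m n : ℕ

  -- Finite sums

  ∑ : (A → ℕ) → List A → ℕ
  ∑ f []       = 0
  ∑ f (x ∷ xs) = f x + ∑ f xs

  syntax ∑ (λ x → e) xs = ∑[ x ∈ xs ] e

  ∑-++ : ∀ (f : A → ℕ) xs ys → ∑ f (xs ++ ys) ≡ ∑ f xs + ∑ f ys
  ∑-++ f []       ys = refl
  ∑-++ f (x ∷ xs) ys = trans (cong (f x +_) (∑-++ f xs ys)) (sym (+-assoc (f x) _ _))

  ∑-cong : ∀ {f g : A → ℕ} → (∀ x → f x ≡ g x) → ∀ xs → ∑ f xs ≡ ∑ g xs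
  ∑-cong f≗g []       = refl
  ∑-cong f≗g (x ∷ xs) = cong₂ _+_ (f≗g x) (∑-cong f≗g xs)

  ∑-mono-≤ : ∀ {f g : A → ℕ} → (∀ x → f x ≤ g x) → ∀ xs → ∑ f xs ≤ ∑ g xs
  ∑-mono-≤ f≤g []       = z≤n
  ∑-mono-≤ f≤g (x ∷ xs) = +-mono-≤ (f≤g x) (∑-mono-≤ f≤g xs)

  ∑-distrib-+ : ∀ (f g : A → ℕ) xs → ∑[ x ∈ xs ] (f x + g x) ≡ ∑ f xs + ∑ g xs
  ∑-distrib-+ f g []       = refl
  ∑-distrib-+ f g (x ∷ xs) =
    trans (cong (f x + g x +_) (∑-distrib-+ f g xs)) (+-interchange (f x) (g x) (∑ f xs) (∑ g xs))

  ∑-concatMap : ∀ (f : B → ℕ) (g : A → List B) xs → ∑ f (concatMap g xs) ≡ ∑[ x ∈ xs ] ∑ f (g x)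
  ∑-concatMap f g []       = refl
  ∑-concatMap f g (x ∷ xs) = trans (∑-++ f (g x) _) (cong (∑ f (g x) +_) (∑-concatMap f g xs))

  ∑-concat-replicate : ∀ (f : A → ℕ) t xs → ∑ f (concat (replicate t xs)) ≡ t * ∑ f xs
  ∑-concat-replicate f zero    xs = refl
  ∑-concat-replicate f (suc t) xs = trans (∑-++ f xs _) (cong (∑ f xs +_) (∑-concat-replicate f t xs))

  ∑-replicate : ∀ (f : A → ℕ) r x → ∑ f (replicate r x) ≡ r * f x
  ∑-replicate f zero    x = refl
  ∑-replicate f (suc r) x = cong (f x +_) (∑-replicate f r x)

  ∑-const : ∀ c (xs : List A) → ∑[ _ ∈ xs ] c ≡ length xs * c
  ∑-const c []       = refl
  ∑-const c (x ∷ xs) = cong (c +_) (∑-const c xs)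

  length≡∑1 : ∀ (xs : List A) → length xs ≡ ∑[ _ ∈ xs ] 1
  length≡∑1 xs = sym (trans (∑-const 1 xs) (*-identityʳ (length xs)))

  ∑-filterᵇ-≤ : ∀ (f : A → ℕ) p xs → ∑ f (filterᵇ p xs) ≤ ∑ f xs
  ∑-filterᵇ-≤ f p []       = z≤n
  ∑-filterᵇ-≤ f p (x ∷ xs) with p x
  ... | true  = +-monoʳ-≤ (f x) (∑-filterᵇ-≤ f p xs)
  ... | false = m≤n⇒m≤o+n (f x) (∑-filterᵇ-≤ f p xs)

  𝟙 : Bool → ℕ
  𝟙 b = if b then 1 else 0

  𝟙≤1 : ∀ b → 𝟙 b ≤ 1
  𝟙≤1 true  = ≤-refl
  𝟙≤1 false = z≤n

  𝟙+𝟙-not : ∀ b → 𝟙 b + 𝟙 (not b) ≡ 1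
  𝟙+𝟙-not true  = refl
  𝟙+𝟙-not false = refl

  length-filterᵇ : ∀ p (xs : List A) → length (filterᵇ p xs) ≡ ∑[ x ∈ xs ] 𝟙 (p x)
  length-filterᵇ p []       = refl
  length-filterᵇ p (x ∷ xs) with p x
  ... | true  = cong suc (length-filterᵇ p xs)
  ... | false = length-filterᵇ p xs

  -- Enumerating 𝔽₂ⁿ

  ∑-allVecs-suc : ∀ m (f : Vec Bool (suc m) → ℕ) →
    ∑ f (allVecs (suc m)) ≡ ∑[ v ∈ allVecs m ] (f (false ∷ v) + f (true ∷ v))
  ∑-allVecs-suc m f = trans (∑-concatMap f _ (allVecs m))
    (∑-cong (λ v → cong (f (false ∷ v) +_) (+-identityʳ (f (true ∷ v)))) (allVecs m))

  length-allVecs : ∀ m → length (allVecs m) ≡ 2 ^ m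
  length-allVecs zero    = refl
  length-allVecs (suc m) = begin
    length (allVecs (suc m))     ≡⟨ length≡∑1 (allVecs (suc m)) ⟩
    ∑[ _ ∈ allVecs (suc m) ] 1   ≡⟨ ∑-allVecs-suc m _ ⟩
    ∑[ _ ∈ allVecs m ] 2         ≡⟨ ∑-const 2 (allVecs m) ⟩
    length (allVecs m) * 2       ≡⟨ cong (_* 2) (length-allVecs m) ⟩
    2 ^ m * 2                    ≡⟨ *-comm (2 ^ m) 2 ⟩
    2 ^ suc m                    ∎
    where open ≡-Reasoning

  ∈-allVecsOver : ∀ m (xs : List A) (v : Vec A m) → (∀ i → lookup v i ∈ xs) → v ∈ allVecsOver m xs
  ∈-allVecsOver zero    xs []      _ = here refl
  ∈-allVecsOver (suc m) xs (a ∷ v) v⊆xs = ∈-concat⁺′ (∈-map⁺ (_∷ v) (v⊆xs zero))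
    (∈-map⁺ (λ w → Data.List.map (_∷ w) xs) (∈-allVecsOver m xs v (v⊆xs ∘ suc)))

  ∈-allVecs : (x : Vec Bool n) → x ∈ allVecs n
  ∈-allVecs {n} x = ∈-allVecsOver n _ x λ i → bool∈ (lookup x i)
    where
    bool∈ : ∀ b → b ∈ false ∷ true ∷ []
    bool∈ false = here refl
    bool∈ true  = there (here refl)

  ∈-allMats : (W : Mat n) → W ∈ allMats n
  ∈-allMats {n} W = ∈-allVecsOver n (allVecs n) W (∈-allVecs ∘ lookup W)

  -- The lower bound

  dotCount : Vec Bool m → ℕ
  dotCount {m} r = ∑[ x ∈ allVecs m ] 𝟙 (dot r x)

  dotCount-true∷ : (r : Vec Bool m) → dotCount (true ∷ r) ≡ 2 ^ m
  dotCount-true∷ {m} r = begin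
    dotCount (true ∷ r)    ≡⟨ ∑-allVecs-suc m _ ⟩
    ∑[ x ∈ allVecs m ] (𝟙 (dot r x) + 𝟙 (not (dot r x)))
                           ≡⟨ ∑-cong (λ x → 𝟙+𝟙-not (dot r x)) (allVecs m) ⟩
    ∑[ _ ∈ allVecs m ] 1   ≡⟨ ∑-const 1 (allVecs m) ⟩
    length (allVecs m) * 1 ≡⟨ *-identityʳ _ ⟩
    length (allVecs m)     ≡⟨ length-allVecs m ⟩
    2 ^ m                  ∎
    where open ≡-Reasoning

  dotCount-false∷ : (r : Vec Bool m) → dotCount (false ∷ r) ≡ 2 * dotCount r
  dotCount-false∷ {m} r = begin
    dotCount (false ∷ r)                         ≡⟨ ∑-allVecs-suc m _ ⟩
    ∑[ x ∈ allVecs m ] (𝟙 (dot r x) + 𝟙 (dot r x)) ≡⟨ ∑-distrib-+ _ _ (allVecs m) ⟩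
    dotCount r + dotCount r                      ≡⟨ cong (dotCount r +_) (+-identityʳ (dotCount r)) ⟨
    2 * dotCount r                               ∎
    where open ≡-Reasoning

  2*dotCount≤2^ : (r : Vec Bool m) → 2 * dotCount r ≤ 2 ^ m
  2*dotCount≤2^ []          = z≤n
  2*dotCount≤2^ (true ∷ r)  = ≤-reflexive (cong (2 *_) (dotCount-true∷ r))
  2*dotCount≤2^ (false ∷ r) rewrite dotCount-false∷ r = *-monoʳ-≤ 2 (2*dotCount≤2^ r)

  2*dotCount≡2^ : (r : Vec Bool m) (j : Fin m) → T (lookup r j) → 2 * dotCount r ≡ 2 ^ m
  2*dotCount≡2^ (true ∷ r)  j       _   = cong (2 *_) (dotCount-true∷ r)
  2*dotCount≡2^ (false ∷ r) (suc j) r≠0 rewrite dotCount-false∷ r = cong (2 *_) (2*dotCount≡2^ r j r≠0)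

  2*∑weight≡m*2^n : (rows : Vec (Vec Bool n) m) → (∀ i → ∃[ j ] T (lookup (lookup rows i) j)) →
    2 * ∑[ x ∈ allVecs n ] weight (Vec.map (λ row → dot row x) rows) ≡ m * 2 ^ n
  2*∑weight≡m*2^n {n} []         _ = cong (2 *_) (trans (∑-const 0 (allVecs n)) (*-zeroʳ (length (allVecs n))))
  2*∑weight≡m*2^n {n} {suc m} (r ∷ rows) rows≠0 with rows≠0 zero
  ... | j , r≠0 = begin
    2 * ∑[ x ∈ allVecs n ] (𝟙 (dot r x) + weight (Vec.map (λ row → dot row x) rows))
      ≡⟨ cong (2 *_) (∑-distrib-+ _ _ (allVecs n)) ⟩
    2 * (dotCount r + ∑[ x ∈ allVecs n ] weight (Vec.map (λ row → dot row x) rows))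
      ≡⟨ *-distribˡ-+ 2 (dotCount r) _ ⟩
    2 * dotCount r + 2 * ∑[ x ∈ allVecs n ] weight (Vec.map (λ row → dot row x) rows)
      ≡⟨ cong₂ _+_ (2*dotCount≡2^ r j r≠0) (2*∑weight≡m*2^n rows (rows≠0 ∘ suc)) ⟩
    2 ^ n + m * 2 ^ n
      ∎
    where open ≡-Reasoning

  ≤-foldr-⊔ : ∀ {x e xs} → x ∈ xs → x ≤ foldr _⊔_ e xs
  ≤-foldr-⊔ {x} x∈xs = foldr-preservesᵒ {P = x ≤_}
    (λ a b → [ m≤n⇒m≤n⊔o b , m≤n⇒m≤o⊔n a ]) _ _ (inj₂ (Any.map ≤-reflexive x∈xs))

  foldr-⊓-≤ : ∀ {x e xs} → x ∈ xs → foldr _⊓_ e xs ≤ x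
  foldr-⊓-≤ {x} x∈xs = foldr-preservesᵒ {P = _≤ x}
    (λ a b → [ m≤n⇒m⊓o≤n b , m≤n⇒o⊓m≤n a ]) _ _ (inj₂ (Any.map (≤-reflexive ∘ sym) x∈xs))

  weight≤M0 : ∀ (W : Mat n) x → weight (mulV W x) ≤ M0 W
  weight≤M0 W x = ≤-foldr-⊔ (∈-map⁺ (λ x → weight (mulV W x)) (∈-allVecs x))

  M0≤ : ∀ (W : Mat n) {B} → (∀ x → weight (mulV W x) ≤ B) → M0 W ≤ B
  M0≤ {n} W {B} bound = foldr-preservesᵇ {P = _≤ B} ⊔-lub z≤n
    (All.map⁺ (All.universal bound (allVecs n)))

  T-and-tabulate⁻ : ∀ n (f : Fin n → Bool) → T (and (toList (tabulate f))) → ∀ i → T (f i)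
  T-and-tabulate⁻ (suc n) f all-f i with f zero in f0
  T-and-tabulate⁻ (suc n) f all-f zero    | true = subst T (sym f0) _
  T-and-tabulate⁻ (suc n) f all-f (suc i) | true = T-and-tabulate⁻ n (f ∘ suc) all-f i

  T-and-tabulate⁺ : ∀ n (f : Fin n → Bool) → (∀ i → T (f i)) → T (and (toList (tabulate f)))
  T-and-tabulate⁺ zero    f all-f = _
  T-and-tabulate⁺ (suc n) f all-f with f zero | all-f zero
  ... | true | _ = T-and-tabulate⁺ n (f ∘ suc) (all-f ∘ suc)

  n≤2*M0 : (W : Mat n) → T (unitDiag W) → n ≤ 2 * M0 W
  n≤2*M0 {n} W diag = *-cancelˡ-≤ (2 ^ n) {{m^n≢0 2 n}} (begin
    2 ^ n * n                                     ≡⟨ *-comm (2 ^ n) n ⟩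
    n * 2 ^ n                                     ≡⟨ 2*∑weight≡m*2^n W (λ i → i , T-and-tabulate⁻ n _ diag i) ⟨
    2 * ∑[ x ∈ allVecs n ] weight (mulV W x)      ≤⟨ *-monoʳ-≤ 2 (∑-mono-≤ (weight≤M0 W) (allVecs n)) ⟩
    2 * ∑[ _ ∈ allVecs n ] M0 W                   ≡⟨ cong (2 *_) (∑-const (M0 W) (allVecs n)) ⟩
    2 * (length (allVecs n) * M0 W)               ≡⟨ cong (λ N → 2 * (N * M0 W)) (length-allVecs n) ⟩
    2 * (2 ^ n * M0 W)                            ≡⟨ *-left-comm 2 (2 ^ n) (M0 W) ⟩
    2 ^ n * (2 * M0 W)                            ∎)
    where open ≤-Reasoning

  n≤2*μ : ∀ n → n ≤ 2 * μ n
  n≤2*μ n = foldr-preservesᵇ {P = λ z → n ≤ 2 * z}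
    (λ {a} {b} n≤2a n≤2b → subst (n ≤_) (sym (*-distribˡ-⊓ 2 a b)) (⊓-glb n≤2a n≤2b))
    (m≤m+n n (n + 0))
    (All.map⁺ (All.map (λ {W} → n≤2*M0 W) (All.all-filter (T? ∘ unitDiag) (allMats n))))

  μ≤M0 : (W : Mat n) → T (unitDiag W) → μ n ≤ M0 W
  μ≤M0 W diag = foldr-⊓-≤ (∈-map⁺ M0 (∈-filter⁺ (T? ∘ unitDiag) (∈-allMats W) diag))

  -- Linear algebra over 𝔽₂

  0ᵥ : Vec Bool k
  0ᵥ = Vec.replicate _ false

  _⊕_ : Vec Bool k → Vec Bool k → Vec Bool k
  _⊕_ = zipWith _xor_

  _•_ : Bool → Vec Bool k → Vec Bool k
  a • v = Vec.map (a ∧_) v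

  infixl 6 _⊕_
  infixr 7 _•_

  dot-comm : (u v : Vec Bool k) → dot u v ≡ dot v u
  dot-comm []      []      = refl
  dot-comm (a ∷ u) (b ∷ v) = cong₂ _xor_ (∧-comm a b) (dot-comm u v)

  dot-0ᵥ : (u : Vec Bool k) → dot u 0ᵥ ≡ false
  dot-0ᵥ []      = refl
  dot-0ᵥ (a ∷ u) rewrite ∧-zeroʳ a = dot-0ᵥ u

  dot-⊕ : (u v w : Vec Bool k) → dot u (v ⊕ w) ≡ dot u v xor dot u w
  dot-⊕ []      []      []      = refl
  dot-⊕ (a ∷ u) (b ∷ v) (c ∷ w) = begin
    a ∧ (b xor c) xor dot u (v ⊕ w)                  ≡⟨ cong₂ _xor_ (∧-distribˡ-xor a b c) (dot-⊕ u v w) ⟩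
    (a ∧ b xor a ∧ c) xor (dot u v xor dot u w)      ≡⟨ xor-interchange (a ∧ b) (a ∧ c) (dot u v) (dot u w) ⟩
    (a ∧ b xor dot u v) xor (a ∧ c xor dot u w)      ∎
    where open ≡-Reasoning

  dot-• : (u : Vec Bool k) (b : Bool) (v : Vec Bool k) → dot u (b • v) ≡ b ∧ dot u v
  dot-• []      b []      = sym (∧-zeroʳ b)
  dot-• (a ∷ u) b (c ∷ v) = begin
    a ∧ (b ∧ c) xor dot u (b • v)   ≡⟨ cong₂ _xor_ (∧-left-comm a b c) (dot-• u b v) ⟩
    b ∧ (a ∧ c) xor b ∧ dot u v     ≡⟨ ∧-distribˡ-xor b (a ∧ c) (dot u v) ⟨
    b ∧ (a ∧ c xor dot u v)         ∎
    where open ≡-Reasoning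

  linearCombination : Vec (Vec Bool k) n → Vec Bool n → Vec Bool k
  linearCombination []       []      = 0ᵥ
  linearCombination (c ∷ cs) (a ∷ x) = a • c ⊕ linearCombination cs x

  dot-linearCombination : (u : Vec Bool k) (cs : Vec (Vec Bool k) n) (x : Vec Bool n) →
    dot u (linearCombination cs x) ≡ dot (Vec.map (dot u) cs) x
  dot-linearCombination u []       []      = dot-0ᵥ u
  dot-linearCombination u (c ∷ cs) (a ∷ x) = begin
    dot u (a • c ⊕ linearCombination cs x)              ≡⟨ dot-⊕ u (a • c) _ ⟩
    dot u (a • c) xor dot u (linearCombination cs x)    ≡⟨ cong₂ _xor_ (dot-• u a c) (dot-linearCombination u cs x) ⟩
    a ∧ dot u c xor dot (Vec.map (dot u) cs) x          ≡⟨ cong (_xor _) (∧-comm a (dot u c)) ⟩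
    dot u c ∧ a xor dot (Vec.map (dot u) cs) x          ∎
    where open ≡-Reasoning

  isNonzero : Vec Bool k → Bool
  isNonzero []      = false
  isNonzero (b ∷ v) = b ∨ isNonzero v

  pivot : Vec Bool k → Vec Bool k
  pivot []          = []
  pivot (true ∷ v)  = true ∷ 0ᵥ
  pivot (false ∷ v) = false ∷ pivot v

  dot-pivot : (v : Vec Bool k) → dot v (pivot v) ≡ isNonzero v
  dot-pivot []          = refl
  dot-pivot (true ∷ v)  rewrite dot-0ᵥ v = refl
  dot-pivot (false ∷ v) = dot-pivot v

  -- The upper bound

  gram : Vec (Vec Bool k) n → Vec (Vec Bool k) n → Mat n
  gram us cs = Vec.map (λ u → Vec.map (dot u) cs) us

  mulV-gram : (us cs : Vec (Vec Bool k) n) (x : Vec Bool n) →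
    mulV (gram us cs) x ≡ Vec.map (λ u → dot u (linearCombination cs x)) us
  mulV-gram us cs x = begin
    Vec.map (λ row → dot row x) (Vec.map (λ u → Vec.map (dot u) cs) us)
      ≡⟨ Vec.map-∘ (λ row → dot row x) (λ u → Vec.map (dot u) cs) us ⟨
    Vec.map (λ u → dot (Vec.map (dot u) cs) x) us
      ≡⟨ Vec.map-cong (λ u → sym (dot-linearCombination u cs x)) us ⟩
    Vec.map (λ u → dot u (linearCombination cs x)) us
      ∎
    where open ≡-Reasoning

  gram-diagonal : (us cs : Vec (Vec Bool k) n) (i : Fin n) →
    lookup (lookup (gram us cs) i) i ≡ dot (lookup us i) (lookup cs i)
  gram-diagonal us cs i = trans (cong (λ row → lookup row i) (Vec.lookup-map i _ us))
    (Vec.lookup-map i (dot (lookup us i)) cs)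

  μ≤-rows : (us : Vec (Vec Bool k) n) → (∀ i → T (isNonzero (lookup us i))) →
    ∀ {B} → (∀ y → weight (Vec.map (λ u → dot u y) us) ≤ B) → μ n ≤ B
  μ≤-rows {n = n} us us≠0 bound = ≤-trans (μ≤M0 W diag) (M0≤ W λ x →
    subst (λ v → weight v ≤ _) (sym (mulV-gram us cs x)) (bound (linearCombination cs x)))
    where
    cs = Vec.map pivot us
    W  = gram us cs
    diag : T (unitDiag W)
    diag = T-and-tabulate⁺ n _ λ i → subst T (sym (begin
      lookup (lookup W i) i                ≡⟨ gram-diagonal us cs i ⟩
      dot (lookup us i) (lookup cs i)      ≡⟨ cong (dot (lookup us i)) (Vec.lookup-map i pivot us) ⟩
      dot (lookup us i) (pivot (lookup us i)) ≡⟨ dot-pivot (lookup us i) ⟩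
      isNonzero (lookup us i)              ∎)) (us≠0 i)
      where open ≡-Reasoning

  weight-map-fromList : ∀ (f : A → Bool) xs → weight (Vec.map f (Vec.fromList xs)) ≡ ∑[ x ∈ xs ] 𝟙 (f x)
  weight-map-fromList f []       = refl
  weight-map-fromList f (x ∷ xs) = cong (𝟙 (f x) +_) (weight-map-fromList f xs)

  μ≤-list : (us : List (Vec Bool k)) → All (T ∘ isNonzero) us →
    ∀ {B} → (∀ y → ∑[ u ∈ us ] 𝟙 (dot u y) ≤ B) → μ (length us) ≤ B
  μ≤-list us us≠0 bound = μ≤-rows (Vec.fromList us) (VecAll.lookup⁺ (VecAll.fromList⁺ us≠0)) λ y →
    subst (_≤ _) (sym (weight-map-fromList (λ u → dot u y) us)) (bound y)

  nonzeroVecs : ∀ k → List (Vec Bool k)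
  nonzeroVecs k = filterᵇ isNonzero (allVecs k)

  1+∑𝟙-isNonzero : ∀ k → 1 + ∑[ v ∈ allVecs k ] 𝟙 (isNonzero v) ≡ 2 ^ k
  1+∑𝟙-isNonzero zero    = refl
  1+∑𝟙-isNonzero (suc m) = begin
    1 + ∑[ v ∈ allVecs (suc m) ] 𝟙 (isNonzero v)   ≡⟨ cong (1 +_) (∑-allVecs-suc m _) ⟩
    1 + ∑[ v ∈ allVecs m ] (𝟙 (isNonzero v) + 1)   ≡⟨ cong (1 +_) (∑-distrib-+ _ _ (allVecs m)) ⟩
    1 + (S + ∑[ _ ∈ allVecs m ] 1)                ≡⟨ cong (λ N → 1 + (S + N)) (sym (length≡∑1 (allVecs m))) ⟩
    1 + S + length (allVecs m)                    ≡⟨ cong₂ _+_ (1+∑𝟙-isNonzero m) (length-allVecs m) ⟩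
    2 ^ m + 2 ^ m                                 ≡⟨ cong (2 ^ m +_) (+-identityʳ (2 ^ m)) ⟨
    2 ^ suc m                                     ∎
    where
    open ≡-Reasoning
    S = ∑[ v ∈ allVecs m ] 𝟙 (isNonzero v)

  1+length-nonzeroVecs : ∀ k → 1 + length (nonzeroVecs k) ≡ 2 ^ k
  1+length-nonzeroVecs k = trans (cong (1 +_) (length-filterᵇ isNonzero (allVecs k))) (1+∑𝟙-isNonzero k)

  ∑-nonzeroVecs-dot≤ : ∀ k (y : Vec Bool (suc k)) → ∑[ u ∈ nonzeroVecs (suc k) ] 𝟙 (dot u y) ≤ 2 ^ k
  ∑-nonzeroVecs-dot≤ k y = *-cancelˡ-≤ 2 (begin
    2 * ∑[ u ∈ nonzeroVecs (suc k) ] 𝟙 (dot u y) ≤⟨ *-monoʳ-≤ 2 (∑-filterᵇ-≤ _ isNonzero (allVecs (suc k))) ⟩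
    2 * ∑[ u ∈ allVecs (suc k) ] 𝟙 (dot u y)     ≡⟨ cong (2 *_) (∑-cong (λ u → cong 𝟙 (dot-comm u y)) (allVecs (suc k))) ⟩
    2 * dotCount y                               ≤⟨ 2*dotCount≤2^ y ⟩
    2 ^ suc k                                    ∎)
    where open ≤-Reasoning

  μ≤-copies : ∀ k t r → μ (r + t * length (nonzeroVecs (suc k))) ≤ r + t * 2 ^ k
  μ≤-copies k t r = subst (λ n → μ n ≤ r + t * 2 ^ k) length-us (μ≤-list us us≠0 bound)
    where
    e₁ : Vec Bool (suc k)
    e₁ = true ∷ 0ᵥ
    vs = nonzeroVecs (suc k)
    us = replicate r e₁ ++ concat (replicate t vs)

    length-us : length us ≡ r + t * length vs
    length-us = begin
      length us                                          ≡⟨ length≡∑1 us ⟩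
      ∑[ _ ∈ us ] 1                                      ≡⟨ ∑-++ _ (replicate r e₁) _ ⟩
      ∑[ _ ∈ replicate r e₁ ] 1 + ∑[ _ ∈ concat (replicate t vs) ] 1
                                                         ≡⟨ cong₂ _+_ (∑-replicate _ r e₁) (∑-concat-replicate _ t vs) ⟩
      r * 1 + t * ∑[ _ ∈ vs ] 1                          ≡⟨ cong₂ _+_ (*-identityʳ r) (cong (t *_) (sym (length≡∑1 vs))) ⟩
      r + t * length vs                                  ∎
      where open ≡-Reasoning

    us≠0 : All (T ∘ isNonzero) us
    us≠0 = All.++⁺ (All.replicate⁺ r _)
      (All.concat⁺ (All.replicate⁺ t (All.all-filter (T? ∘ isNonzero) (allVecs (suc k)))))

    bound : ∀ y → ∑[ u ∈ us ] 𝟙 (dot u y) ≤ r + t * 2 ^ k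
    bound y = begin
      ∑[ u ∈ us ] 𝟙 (dot u y)                            ≡⟨ ∑-++ _ (replicate r e₁) _ ⟩
      ∑[ u ∈ replicate r e₁ ] 𝟙 (dot u y) + ∑[ u ∈ concat (replicate t vs) ] 𝟙 (dot u y)
                                                         ≡⟨ cong₂ _+_ (∑-replicate _ r e₁) (∑-concat-replicate _ t vs) ⟩
      r * 𝟙 (dot e₁ y) + t * ∑[ u ∈ vs ] 𝟙 (dot u y)      ≤⟨ +-mono-≤ (*-monoʳ-≤ r (𝟙≤1 _)) (*-monoʳ-≤ t (∑-nonzeroVecs-dot≤ k y)) ⟩
      r * 1 + t * 2 ^ k                                  ≡⟨ cong (_+ t * 2 ^ k) (*-identityʳ r) ⟩
      r + t * 2 ^ k                                      ∎
      where open ≤-Reasoning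

  2μ≤n+t+r : ∀ k {n t r} → n ≡ r + t * length (nonzeroVecs (suc k)) → 2 * μ n ≤ n + (t + r)
  2μ≤n+t+r k {t = t} {r} refl = begin
    2 * μ (r + t * L)         ≤⟨ *-monoʳ-≤ 2 (μ≤-copies k t r) ⟩
    2 * (r + t * 2 ^ k)       ≡⟨ *-distribˡ-+ 2 r _ ⟩
    2 * r + 2 * (t * 2 ^ k)   ≡⟨ cong (2 * r +_) (*-left-comm 2 t (2 ^ k)) ⟩
    2 * r + t * 2 ^ suc k     ≡⟨ cong (λ N → 2 * r + t * N) (1+length-nonzeroVecs (suc k)) ⟨
    2 * r + t * (1 + L)       ≡⟨ regroup r t L ⟩
    r + t * L + (t + r)       ∎
    where
    open ≤-Reasoning
    L = length (nonzeroVecs (suc k))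
    regroup : ∀ r t L → 2 * r + t * (1 + L) ≡ r + t * L + (t + r)
    regroup = solve-∀

  -- Since q ≤ L and n > L², the excess 2μ(n) ∸ n ≤ n / L + n % L is below 2n / q.
  excess-bound : ∀ {q L n t r d} → q ≤ L → L * L < n → n ≡ r + t * L → r < L →
    d ≤ t + r → q * d < 2 * n
  excess-bound {q} {L} {n} {t} {r} {d} q≤L L²<n n≡r+tL r<L d≤t+r = begin-strict
    q * d              ≤⟨ *-mono-≤ q≤L d≤t+r ⟩
    L * (t + r)        ≡⟨ *-distribˡ-+ L t r ⟩
    L * t + L * r      ≤⟨ +-mono-≤ (≤-reflexive (*-comm L t)) (*-monoʳ-≤ L (<⇒≤ r<L)) ⟩
    t * L + L * L      ≤⟨ +-monoˡ-≤ (L * L) (m≤n+m (t * L) r) ⟩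
    r + t * L + L * L  ≡⟨ cong (_+ L * L) n≡r+tL ⟨
    n + L * L          <⟨ +-monoʳ-< n L²<n ⟩
    n + n              ≡⟨ cong (n +_) (+-identityʳ n) ⟨
    2 * n              ∎
    where open ≤-Reasoning

  n<2^n : ∀ n → n < 2 ^ n
  n<2^n zero    = s≤s z≤n
  n<2^n (suc n) = subst (suc (suc n) ≤_) (cong (2 ^ n +_) (sym (+-identityʳ (2 ^ n))))
    (+-mono-≤ (m^n>0 2 n) (n<2^n n))

  ≤-length-nonzeroVecs : ∀ k → k ≤ length (nonzeroVecs k)
  ≤-length-nonzeroVecs k = s≤s⁻¹ (subst (suc k ≤_) (sym (1+length-nonzeroVecs k)) (n<2^n k))

open import Defs
open import Data.Integer as ℤ using (+_)
import Data.Integer.Properties as ℤ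
open import Data.List using (length)
open import Data.Nat as ℕ using (ℕ; NonZero; _≤_; suc; _*_; _∸_)
open import Data.Nat.DivMod using (m≡m%n+[m/n]*n; m%n<n)
import Data.Nat.Properties as ℕ
open import Data.Product using (∃-syntax; _,_)
open import Data.Rational using (ℚ; mkℚ; _/_; _-_; ∣_∣; ½; _<_; 0ℚ; ↧ₙ_; toℚᵘ)
import Data.Rational as ℚ
open import Data.Rational.Properties
  using (toℚᵘ-homo-+; toℚᵘ-homo‿-; toℚᵘ-fromℚᵘ; toℚᵘ-cancel-≤; toℚᵘ-cancel-<; 0≤p⇒∣p∣≡p)
open import Data.Rational.Unnormalised as ℚᵘ using (mkℚᵘ; _≃_; *<*)
import Data.Rational.Unnormalised.Properties as ℚᵘ
open import Relation.Binary.PropositionalEquality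

-- mkℚᵘ stores the denominator minus one: the right-hand side is (2a − (m + 1)) / (2m + 2).
toℚᵘ-a/n-½ : ∀ a m → suc m ℕ.≤ 2 * a →
  toℚᵘ ((+ a) / suc m - ½) ≃ mkℚᵘ (+ (2 * a ∸ suc m)) (suc (m * 2))
toℚᵘ-a/n-½ a m n≤2a = ℚᵘ.≃-trans
  (ℚᵘ.≃-trans (toℚᵘ-homo-+ ((+ a) / suc m) (ℚ.- ½))
              (ℚᵘ.+-cong (toℚᵘ-fromℚᵘ (mkℚᵘ (+ a) m)) (toℚᵘ-homo‿- ½)))
  (ℚᵘ.≃-reflexive (cong (λ i → mkℚᵘ i (suc (m * 2))) numerator))
  where
  numerator : + a ℤ.* + 2 ℤ.+ ℤ.-[1+ 0 ] ℤ.* + suc m ≡ + (2 * a ∸ suc m)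
  numerator = begin
    + a ℤ.* + 2 ℤ.+ ℤ.-[1+ 0 ] ℤ.* + suc m   ≡⟨ cong₂ ℤ._+_ (sym (ℤ.pos-* a 2)) (ℤ.-1*i≡-i (+ suc m)) ⟩
    + (a * 2) ℤ.+ ℤ.- + suc m              ≡⟨ ℤ.m-n≡m⊖n (a * 2) (suc m) ⟩
    (a * 2) ℤ.⊖ suc m                      ≡⟨ ℤ.⊖-≥ (subst (suc m ℕ.≤_) (ℕ.*-comm 2 a) n≤2a) ⟩
    + (a * 2 ∸ suc m)                      ≡⟨ cong (λ b → + (b ∸ suc m)) (ℕ.*-comm a 2) ⟩
    + (2 * a ∸ suc m)                      ∎
    where open ≡-Reasoning

∣a/n-½∣<ε : ∀ ε → 0ℚ < ε → ∀ a m → suc m ≤ 2 * a → ↧ₙ ε * (2 * a ∸ suc m) ℕ.< 2 * suc m →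
  ∣ (+ a) / suc m - ½ ∣ < ε
∣a/n-½∣<ε (mkℚ (+ 0) _ _)      (ℚ.*<* (ℤ.+<+ ()))
∣a/n-½∣<ε (mkℚ ℤ.-[1+ _ ] _ _) (ℚ.*<* ())
∣a/n-½∣<ε ε@(mkℚ ℤ.+[1+ p ] q-1 _) _ a m n≤2a excess<2n = subst (_< ε) (sym (0≤p⇒∣p∣≡p 0≤x)) x<ε
  where
  x = (+ a) / suc m - ½
  e = 2 * a ∸ suc m
  x≃ = ℚᵘ.≃-sym (toℚᵘ-a/n-½ a m n≤2a)

  0≤x : 0ℚ ℚ.≤ x
  0≤x = toℚᵘ-cancel-≤ (ℚᵘ.≤-respʳ-≃ x≃ (ℚᵘ.nonNegative⁻¹ (mkℚᵘ (+ e) (suc (m * 2)))))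

  cross : e * suc q-1 ℕ.< suc p * (suc m * 2)
  cross = ℕ.<-≤-trans (subst₂ ℕ._<_ (ℕ.*-comm (suc q-1) e) (ℕ.*-comm 2 (suc m)) excess<2n)
                      (ℕ.m≤n*m (suc m * 2) (suc p))

  x<ε : x < ε
  x<ε = toℚᵘ-cancel-< (ℚᵘ.<-respˡ-≃ x≃
    (*<* (subst₂ ℤ._<_ (ℤ.pos-* e (suc q-1)) (ℤ.pos-* (suc p) (suc m * 2)) (ℤ.+<+ cross))))

theorem1p2 : (ε : ℚ) → 0ℚ < ε →
    ∃[ N ] ((n : ℕ) .{{_ : NonZero n}} → N ≤ n →
      ∣ (+ μ n) / n - ½ ∣ < ε)
theorem1p2 ε 0<ε = suc (L * L) , close
  where
  open Bounds
  k = ℚ.ℚ.denominator-1 ε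
  L = length (nonzeroVecs (suc k))

  instance
    L≢0 : NonZero L
    L≢0 = ℕ.>-nonZero (ℕ.<-≤-trans ℕ.z<s (≤-length-nonzeroVecs (suc k)))

  close : (n : ℕ) .{{_ : NonZero n}} → suc (L * L) ≤ n → ∣ (+ μ n) / n - ½ ∣ < ε
  close n@(suc m) L²<n = ∣a/n-½∣<ε ε 0<ε (μ n) m (n≤2*μ n)
    (excess-bound {t = t} {r} (≤-length-nonzeroVecs (suc k)) L²<n n≡r+tL (m%n<n n L)
      (ℕ.m≤n+o⇒m∸n≤o (2 * μ n) n (2μ≤n+t+r k {t = t} {r} n≡r+tL)))
    where
    t = n ℕ./ L
    r = n ℕ.% L
    n≡r+tL : n ≡ r ℕ.+ t * L
    n≡r+tL = m≡m%n+[m/n]*n n L
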